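{- Let $\partial_F$, $\hat{x}_F$, $\ast_F$, $x^{n^{\ast}_F}$, $\exp_F$ be as in the context, let $D$ denote the ordinary derivative $Dx^n=nx^{n-1}$ on $\mathbb{R}[[x]]$, and let $\alpha,\beta\in\mathbb{R}$. Then: (a) $\partial_F x^{n^{\ast}_F}=n\,x^{(n-1)^{\ast}_F}$ for all $n\ge 0$ (with the right-hand side read as $0$ when $n=0$); (b) $\exp_F[\alpha x]=\exp\{\alpha\hat{x}_F\}\mathbf{1}$, where $\exp\{\alpha\hat{x}_F\}\mathbf{1}:=\sum_{k\ge0}\frac{\alpha^k}{k!}\hat{x}_F^{\,k}\mathbf{1}$; (c) $\exp[\alpha x]\ast_F \exp_F[\beta x]=\exp_F[(\alpha+\beta)x]$, where $\exp[\alpha x]=\sum_{k\ge0}\alpha^kx^k/k!$; (d) $\partial_F\big(x^k\ast_F x^{n^{\ast}_F}\big)=(Dx^k)\ast_F x^{n^{\ast}_F}+x^k\ast_F\big(\partial_F x^{n^{\ast}_F}\big)$ for all $k,n\ge0$; (e) (Leibniz rule) $\partial_F(f\ast_F g)=(Df)\ast_F g+f\ast_F(\partial_F g)$ for all formal series $f,g\in\mathbb{R}[[x]]$; (f) for all $f,g\in\mathbb{R}[[x]]$, $f(\hat{x}_F)g(\hat{x}_F)\mathbf{1}=f(x)\ast_F\tilde g$, where $\tilde g(x)=g(\hat{x}_F)\mathbf{1}$.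
   Context: Let $F_n$ be the Fibonacci numbers ($F_0=0$, $F_1=F_2=1$, $F_{n+1}=F_n+F_{n-1}$). Write $n_F:=F_n$, $n_F!:=n_F(n-1)_F\cdots 2_F1_F$ for $n\ge1$ and $0_F!:=1$. Work in the space $\mathbb{R}[[x]]$ of formal power series with real coefficients, and write $\mathbf{1}=x^0$. Define $\exp_F[y]:=\sum_{k\ge0}\frac{y^k}{k_F!}$ (so $\exp_F[\alpha x]=\sum_k \alpha^kx^k/k_F!$). Let $\partial_F$ be the linear operator on $\mathbb{R}[[x]]$ (acting termwise) with $\partial_F x^n=n_F x^{n-1}$ for $n\ge1$ and $\partial_F x^0=0$. Let $\hat{x}_F$ be the linear operator (acting termwise) with $\hat{x}_F(x^n)=\frac{n+1}{(n+1)_F}x^{n+1}$ for $n\ge0$. For $f(x)=\sum_k a_kx^k\in\mathbb{R}[[x]]$ put $f(\hat{x}_F):=\sum_k a_k\hat{x}_F^{\,k}$ (well defined on formal series since $\hat x_F^{\,k}$ raises degree by $k$), and define the (noncommutative) product $f\ast_F g:=f(\hat{x}_F)g$ for $f,g\in\mathbb{R}[[x]]$; in particular $f(x)\ast_F x^n=f(\hat{x}_F)x^n$. The $\ast_F$-powers are $x^{n^{\ast}_F}:=x\ast_F x^{(n-1)^{\ast}_F}=\hat{x}_F^{\,n}\mathbf{1}=\frac{n!}{n_F!}x^n$ for $n\ge0$, with $x^{0^{\ast}_F}=1$. -}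

module Defs where

open import Level using (_⊔_) renaming (suc to lsuc)
open import Data.Nat using (ℕ; zero; suc; _!; _≡ᵇ_)
import Data.Nat as N
open import Data.Bool using (if_then_else_)
open import Algebra.Bundles using (CommutativeRing)

fib : ℕ → ℕ
fib zero = zero
fib (suc zero) = suc zero
fib (suc (suc n)) = fib (suc n) N.+ fib n

fibFact : ℕ → ℕ
fibFact zero = suc zero
fibFact (suc n) = fib (suc n) N.* fibFact n

natR : ∀ {c ℓ} (R : CommutativeRing c ℓ) → ℕ → CommutativeRing.Carrier R
natR R zero = CommutativeRing.0# R
natR R (suc n) = CommutativeRing._+_ R (CommutativeRing.1# R) (natR R n)

-- Coefficient ring: a commutative ring in which every positive integer is
-- invertible (i.e. a commutative Q-algebra; R is the instance of the paper).
record QAlgebra (c ℓ : Level.Level) : Set (lsuc (c ⊔ ℓ)) where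
  field
    coeffRing : CommutativeRing c ℓ
    recip     : ℕ → CommutativeRing.Carrier coeffRing     -- recip n = 1/(n+1)
    recip-inv : ∀ n → let open CommutativeRing coeffRing in
                natR coeffRing (suc n) * recip n ≈ 1#

module QOps {c ℓ} (A : QAlgebra c ℓ) where
  open QAlgebra A public
  open CommutativeRing coeffRing public

  nat : ℕ → Carrier
  nat = natR coeffRing

  -- 1/n for n ≥ 1 (value at 0 is irrelevant and never used)
  inv : ℕ → Carrier
  inv zero = 0#
  inv (suc n) = recip n

  pow : Carrier → ℕ → Carrier
  pow a zero = 1#
  pow a (suc k) = a * pow a k

  sumTo : ℕ → (ℕ → Carrier) → Carrier
  sumTo zero h = 0#
  sumTo (suc n) h = sumTo n h + h n

  Series : Set c
  Series = ℕ → Carrier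

  _≋_ : Series → Series → Set ℓ
  f ≋ g = ∀ n → f n ≈ g n

  zeroS : Series
  zeroS _ = 0#

  _⊕_ : Series → Series → Series
  (f ⊕ g) n = f n + g n

  _·_ : Carrier → Series → Series
  (a · f) n = a * f n

  _⊙_ : Series → Series → Series
  (f ⊙ g) n = sumTo (suc n) (λ i → f i * g (n N.∸ i))

  mono : ℕ → Series
  mono n m = if n ≡ᵇ m then 1# else 0#

  𝟏 : Series
  𝟏 = mono 0

  D : Series → Series
  D f n = nat (suc n) * f (suc n)

  ∂F : Series → Series
  ∂F f n = nat (fib (suc n)) * f (suc n)

  x̂ : Series → Series
  x̂ f zero = 0#
  x̂ f (suc n) = nat (suc n) * inv (fib (suc n)) * f n

  x̂^ : ℕ → Series → Series
  x̂^ zero g = g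
  x̂^ (suc k) g = x̂ (x̂^ k g)

  -- f(x̂_F) g = Σ_k f_k x̂_F^k g ; since x̂_F^k raises degree by k, only
  -- k ≤ m contributes to the coefficient of x^m.
  applyAt : Series → Series → Series
  applyAt f g m = sumTo (suc m) (λ k → f k * x̂^ k g m)

  _∗_ : Series → Series → Series
  f ∗ g = applyAt f g

  starPow : ℕ → Series
  starPow n = x̂^ n 𝟏

  expS : Carrier → Series
  expS a k = pow a k * inv (k !)

  expF : Carrier → Series
  expF a k = pow a k * inv (fibFact k)

  expHat𝟏 : Carrier → Series
  expHat𝟏 a = applyAt (expS a) 𝟏

{-# OPTIONS --safe #-}
-- The operator x̂_F is built so that x̂_F ∂_F and ∂_F x̂_F act on x^n as multiplication by
-- n and n + 1.  Hence ∂_F x̂_F − x̂_F ∂_F = 1, and by induction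
-- ∂_F x̂_F^(k+1) = (k+1) x̂_F^k + x̂_F^(k+1) ∂_F; summed termwise over f(x̂_F) g this is the
-- Leibniz rule (e), of which (d) is a special case, and applied to 1 it gives (a).
-- Conjugated by the diagonal scaling x^n ↦ (n!/n_F!) x^n, x̂_F becomes multiplication by x,
-- so f(x̂_F) 1 is f rescaled coefficientwise and f(x̂_F) (g(x̂_F) 1) = (f g)(x̂_F) 1, which
-- is (f); (b) is the case f = exp[α x].  For (c), both sides are eigenseries of ∂_F for the
-- eigenvalue α + β (by (e)) with constant term 1, and the constant term determines such a
-- series.
module Submission where

open import Defs
open import Data.Nat using (ℕ; zero; suc; _!; NonZero; >-nonZero; >-nonZero⁻¹; s≤s)
import Data.Nat as N
open import Data.Nat.Properties using (m*n≢0; _!≢0; <-≤-trans; m≤m+n; m<n⇒m<1+n; ≤-refl; ≤-pred)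
open import Data.Product using (_×_; _,_)
open import Relation.Binary.PropositionalEquality as ≡ using (_≡_)
open import Algebra.Bundles using (CommutativeRing)

module NatR {c ℓ} (R : CommutativeRing c ℓ) where
  open CommutativeRing R
  open import Algebra.Properties.Semiring.Mult semiring using (×1-homo-*) renaming (_×_ to _times_)

  natR≈times1# : ∀ n → natR R n ≈ n times 1#
  natR≈times1# zero = refl
  natR≈times1# (suc n) = +-congˡ (natR≈times1# n)

  natR-* : ∀ m n → natR R (m N.* n) ≈ natR R m * natR R n
  natR-* m n = trans (natR≈times1# (m N.* n))
    (trans (×1-homo-* m n) (sym (*-cong (natR≈times1# m) (natR≈times1# n))))

  natR-suc-* : ∀ n x → natR R (suc n) * x ≈ x + natR R n * x
  natR-suc-* n x = trans (distribʳ x 1# (natR R n)) (+-congʳ (*-identityˡ x))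

fib-nonZero : ∀ n → NonZero (fib (suc n))
fib-nonZero zero = _
fib-nonZero (suc n) =
  >-nonZero (<-≤-trans (>-nonZero⁻¹ (fib (suc n)) {{fib-nonZero n}}) (m≤m+n (fib (suc n)) (fib n)))

fibFact-nonZero : ∀ n → NonZero (fibFact n)
fibFact-nonZero zero = _
fibFact-nonZero (suc n) = m*n≢0 (fib (suc n)) (fibFact n) {{fib-nonZero n}} {{fibFact-nonZero n}}

module Development {c ℓ} (A : QAlgebra c ℓ) where
  open QOps A
  open NatR coeffRing
  open import Algebra.Solver.Ring.NaturalCoefficients.Default commutativeSemiring
  open import Algebra.Properties.CommutativeSemigroup *-commutativeSemigroup
    using (interchange; x∙yz≈y∙xz)
  open import Relation.Binary.Reasoning.Setoid setoid

  inv-inverseʳ : ∀ n .{{_ : NonZero n}} → nat n * inv n ≈ 1#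
  inv-inverseʳ (suc n) = recip-inv n

  inv-unique : ∀ n .{{_ : NonZero n}} {x} → nat n * x ≈ 1# → x ≈ inv n
  inv-unique n {x} nx≈1 = begin
    x                      ≈⟨ sym (*-identityʳ x) ⟩
    x * 1#                 ≈⟨ *-congˡ (sym (inv-inverseʳ n)) ⟩
    x * (nat n * inv n)    ≈⟨ solve 3 (λ x a b → x :* (a :* b) := (a :* x) :* b) refl x (nat n) (inv n) ⟩
    (nat n * x) * inv n    ≈⟨ *-congʳ nx≈1 ⟩
    1# * inv n             ≈⟨ *-identityˡ (inv n) ⟩
    inv n                  ∎

  inv-* : ∀ m n .{{_ : NonZero m}} .{{_ : NonZero n}} → inv (m N.* n) ≈ inv m * inv n
  inv-* m n = sym (inv-unique (m N.* n) {{m*n≢0 m n}} (begin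
    nat (m N.* n) * (inv m * inv n)      ≈⟨ *-congʳ (natR-* m n) ⟩
    (nat m * nat n) * (inv m * inv n)    ≈⟨ interchange (nat m) (nat n) (inv m) (inv n) ⟩
    (nat m * inv m) * (nat n * inv n)    ≈⟨ *-cong (inv-inverseʳ m) (inv-inverseʳ n) ⟩
    1# * 1#                              ≈⟨ *-identityˡ 1# ⟩
    1#                                   ∎))

  inv-1 : inv 1 ≈ 1#
  inv-1 = sym (inv-unique 1 (trans (*-identityʳ (nat 1)) (+-identityʳ 1#)))

  sumTo-cong : ∀ n {h h′ : ℕ → Carrier} → (∀ i → i N.< n → h i ≈ h′ i) → sumTo n h ≈ sumTo n h′
  sumTo-cong zero eq = refl
  sumTo-cong (suc n) eq = +-cong (sumTo-cong n (λ i i<n → eq i (m<n⇒m<1+n i<n))) (eq n ≤-refl)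

  sumTo-zero : ∀ n (h : ℕ → Carrier) → (∀ i → i N.< n → h i ≈ 0#) → sumTo n h ≈ 0#
  sumTo-zero n h vanish = trans (sumTo-cong n vanish) (zero-sum n)
    where
    zero-sum : ∀ n → sumTo n (λ _ → 0#) ≈ 0#
    zero-sum zero = refl
    zero-sum (suc n) = trans (+-identityʳ _) (zero-sum n)

  sumTo-+ : ∀ n (h h′ : ℕ → Carrier) → sumTo n (λ i → h i + h′ i) ≈ sumTo n h + sumTo n h′
  sumTo-+ zero h h′ = sym (+-identityʳ 0#)
  sumTo-+ (suc n) h h′ = trans (+-congʳ (sumTo-+ n h h′))
    (solve 4 (λ a b c d → (a :+ b) :+ (c :+ d) := (a :+ c) :+ (b :+ d)) refl _ _ _ _)

  *-distribˡ-sumTo : ∀ n a (h : ℕ → Carrier) → a * sumTo n h ≈ sumTo n (λ i → a * h i)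
  *-distribˡ-sumTo zero a h = zeroʳ a
  *-distribˡ-sumTo (suc n) a h = trans (distribˡ a _ _) (+-congʳ (*-distribˡ-sumTo n a h))

  sumTo-suc-head : ∀ n (h : ℕ → Carrier) → sumTo (suc n) h ≈ h 0 + sumTo n (λ i → h (suc i))
  sumTo-suc-head zero h = +-comm 0# (h 0)
  sumTo-suc-head (suc n) h = trans (+-congʳ (sumTo-suc-head n h)) (+-assoc _ _ _)

  -- D and ∂F are definitionally weightedD (λ n → n) and weightedD fib.
  weightedD : (ℕ → ℕ) → Series → Series
  weightedD w f n = nat (w (suc n)) * f (suc n)

  weightedD-eigen-exp : (w d : ℕ → ℕ) → (∀ n → NonZero (w (suc n))) → (∀ n → NonZero (d n)) →
                        (∀ n → d (suc n) ≡ w (suc n) N.* d n) →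
                        ∀ a → weightedD w (λ n → pow a n * inv (d n)) ≋ (a · (λ n → pow a n * inv (d n)))
  weightedD-eigen-exp w d w≢0 d≢0 d-suc a n = begin
    W * ((a * p) * inv (d (suc n)))           ≈⟨ *-congˡ (*-congˡ (reflexive (≡.cong inv (d-suc n)))) ⟩
    W * ((a * p) * inv (w (suc n) N.* d n))   ≈⟨ *-congˡ (*-congˡ (inv-* _ _ {{w≢0 n}} {{d≢0 n}})) ⟩
    W * ((a * p) * (inv (w (suc n)) * q))
      ≈⟨ solve 5 (λ W a p i q → W :* ((a :* p) :* (i :* q)) := (W :* i) :* (a :* (p :* q)))
               refl W a p (inv (w (suc n))) q ⟩
    (W * inv (w (suc n))) * (a * (p * q))     ≈⟨ *-congʳ (inv-inverseʳ (w (suc n)) {{w≢0 n}}) ⟩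
    1# * (a * (p * q))                        ≈⟨ *-identityˡ _ ⟩
    a * (p * q)                               ∎
    where W = nat (w (suc n)); p = pow a n; q = inv (d n)

  weightedD-eigen-unique : (w : ℕ → ℕ) → (∀ n → NonZero (w (suc n))) → ∀ a {h h′} →
                           weightedD w h ≋ (a · h) → weightedD w h′ ≋ (a · h′) → h 0 ≈ h′ 0 → h ≋ h′
  weightedD-eigen-unique w w≢0 a {h} {h′} eigen eigen′ h0≈h′0 = go
    where
    coeff-suc : ∀ g n → g (suc n) ≈ inv (w (suc n)) * weightedD w g n
    coeff-suc g n = begin
      g (suc n)                                   ≈⟨ sym (*-identityˡ _) ⟩
      1# * g (suc n)                              ≈⟨ *-congʳ (sym (trans (*-comm _ _) (inv-inverseʳ _ {{w≢0 n}}))) ⟩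
      (inv (w (suc n)) * nat (w (suc n))) * g (suc n) ≈⟨ *-assoc _ _ _ ⟩
      inv (w (suc n)) * weightedD w g n           ∎

    go : h ≋ h′
    go zero = h0≈h′0
    go (suc n) = begin
      h (suc n)                          ≈⟨ coeff-suc h n ⟩
      inv (w (suc n)) * weightedD w h n  ≈⟨ *-congˡ (trans (eigen n) (*-congˡ (go n))) ⟩
      inv (w (suc n)) * (a * h′ n)       ≈⟨ *-congˡ (sym (eigen′ n)) ⟩
      inv (w (suc n)) * weightedD w h′ n ≈⟨ sym (coeff-suc h′ n) ⟩
      h′ (suc n)                         ∎

  x̂-cong : ∀ {h h′} → h ≋ h′ → x̂ h ≋ x̂ h′
  x̂-cong eq zero = refl
  x̂-cong eq (suc n) = *-congˡ (eq n)

  x̂^-cong : ∀ k {h h′} → h ≋ h′ → x̂^ k h ≋ x̂^ k h′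
  x̂^-cong zero eq = eq
  x̂^-cong (suc k) eq = x̂-cong (x̂^-cong k eq)

  x̂-· : ∀ a h → x̂ (a · h) ≋ (a · x̂ h)
  x̂-· a h zero = sym (zeroʳ a)
  x̂-· a h (suc n) = x∙yz≈y∙xz _ a (h n)

  x̂^-· : ∀ k a h → x̂^ k (a · h) ≋ (a · x̂^ k h)
  x̂^-· zero a h n = refl
  x̂^-· (suc k) a h n = trans (x̂-cong (x̂^-· k a h) n) (x̂-· a (x̂^ k h) n)

  x̂-⊕ : ∀ h h′ → x̂ (h ⊕ h′) ≋ (x̂ h ⊕ x̂ h′)
  x̂-⊕ h h′ zero = sym (+-identityʳ 0#)
  x̂-⊕ h h′ (suc n) = distribˡ _ _ _

  x̂^-zero : ∀ k {h} → h ≋ zeroS → x̂^ k h ≋ zeroS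
  x̂^-zero zero h≈0 = h≈0
  x̂^-zero (suc k) h≈0 zero = refl
  x̂^-zero (suc k) h≈0 (suc n) = trans (*-congˡ (x̂^-zero k h≈0 n)) (zeroʳ _)

  x̂^-raises-degree : ∀ k {m} h → m N.< k → x̂^ k h m ≈ 0#
  x̂^-raises-degree (suc k) {zero} h _ = refl
  x̂^-raises-degree (suc k) {suc m} h (s≤s m<k) = trans (*-congˡ (x̂^-raises-degree k h m<k)) (zeroʳ _)

  fib-*-x̂-weight : ∀ n x → nat (fib (suc n)) * (nat (suc n) * inv (fib (suc n)) * x) ≈ nat (suc n) * x
  fib-*-x̂-weight n x = begin
    F * (s * i * x)    ≈⟨ solve 4 (λ F s i x → F :* (s :* i :* x) := s :* ((F :* i) :* x)) refl F s i x ⟩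
    s * ((F * i) * x)  ≈⟨ *-congˡ (*-congʳ (inv-inverseʳ (fib (suc n)) {{fib-nonZero n}})) ⟩
    s * (1# * x)       ≈⟨ *-congˡ (*-identityˡ x) ⟩
    s * x              ∎
    where F = nat (fib (suc n)); s = nat (suc n); i = inv (fib (suc n))

  x̂-weight-*-fib : ∀ n x → nat (suc n) * inv (fib (suc n)) * (nat (fib (suc n)) * x) ≈ nat (suc n) * x
  x̂-weight-*-fib n x = trans (x∙yz≈y∙xz _ _ x) (fib-*-x̂-weight n x)

  ∂F-𝟏 : ∂F 𝟏 ≋ zeroS
  ∂F-𝟏 n = zeroʳ _

  ∂F-x̂ : ∀ h → ∂F (x̂ h) ≋ (h ⊕ x̂ (∂F h))
  ∂F-x̂ h m = begin
    ∂F (x̂ h) m          ≈⟨ fib-*-x̂-weight m (h m) ⟩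
    nat (suc m) * h m   ≈⟨ natR-suc-* m (h m) ⟩
    h m + nat m * h m   ≈⟨ +-congˡ (x̂-∂F m) ⟩
    h m + x̂ (∂F h) m    ∎
    where
    x̂-∂F : ∀ m → nat m * h m ≈ x̂ (∂F h) m
    x̂-∂F zero = zeroˡ (h 0)
    x̂-∂F (suc m) = sym (x̂-weight-*-fib m (h (suc m)))

  ∂F-x̂^ : ∀ k g → ∂F (x̂^ (suc k) g) ≋ ((nat (suc k) · x̂^ k g) ⊕ x̂^ (suc k) (∂F g))
  ∂F-x̂^ zero g m = trans (∂F-x̂ g m) (+-congʳ (sym nat1*g))
    where
    nat1*g : nat 1 * g m ≈ g m
    nat1*g = trans (natR-suc-* 0 (g m)) (trans (+-congˡ (zeroˡ (g m))) (+-identityʳ (g m)))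
  ∂F-x̂^ (suc k) g m = begin
    ∂F (x̂ X) m                                  ≈⟨ ∂F-x̂ X m ⟩
    X m + x̂ (∂F X) m                            ≈⟨ +-congˡ (x̂-cong (∂F-x̂^ k g) m) ⟩
    X m + x̂ ((nat (suc k) · x̂^ k g) ⊕ Y) m      ≈⟨ +-congˡ (x̂-⊕ _ Y m) ⟩
    X m + (x̂ (nat (suc k) · x̂^ k g) m + x̂ Y m)  ≈⟨ +-congˡ (+-congʳ (x̂-· _ _ m)) ⟩
    X m + (nat (suc k) * X m + x̂ Y m)           ≈⟨ sym (+-assoc _ _ _) ⟩
    (X m + nat (suc k) * X m) + x̂ Y m           ≈⟨ +-congʳ (sym (natR-suc-* (suc k) (X m))) ⟩
    nat (suc (suc k)) * X m + x̂ Y m             ∎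
    where X = x̂^ (suc k) g; Y = x̂^ (suc k) (∂F g)

  ∂F-starPow : ∀ n → ∂F (starPow (suc n)) ≋ (nat (suc n) · starPow n)
  ∂F-starPow n m = begin
    ∂F (x̂^ (suc n) 𝟏) m                                ≈⟨ ∂F-x̂^ n 𝟏 m ⟩
    nat (suc n) * starPow n m + x̂^ (suc n) (∂F 𝟏) m    ≈⟨ +-congˡ (x̂^-zero (suc n) ∂F-𝟏 m) ⟩
    nat (suc n) * starPow n m + 0#                     ≈⟨ +-identityʳ _ ⟩
    nat (suc n) * starPow n m                          ∎

  ∗-congˡ : ∀ {f f′} g → f ≋ f′ → (f ∗ g) ≋ (f′ ∗ g)
  ∗-congˡ g eq m = sumTo-cong (suc m) (λ k _ → *-congʳ (eq k))

  ∗-congʳ : ∀ f {g g′} → g ≋ g′ → (f ∗ g) ≋ (f ∗ g′)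
  ∗-congʳ f eq m = sumTo-cong (suc m) (λ k _ → *-congˡ (x̂^-cong k eq m))

  ∗-·ˡ : ∀ a f g → ((a · f) ∗ g) ≋ (a · (f ∗ g))
  ∗-·ˡ a f g m = trans (sumTo-cong (suc m) (λ k _ → *-assoc _ _ _)) (sym (*-distribˡ-sumTo (suc m) a _))

  ∗-·ʳ : ∀ a f g → (f ∗ (a · g)) ≋ (a · (f ∗ g))
  ∗-·ʳ a f g m = trans
    (sumTo-cong (suc m) (λ k _ → trans (*-congˡ (x̂^-· k a g m)) (x∙yz≈y∙xz (f k) a _)))
    (sym (*-distribˡ-sumTo (suc m) a _))

  ∂F-∗ : ∀ f g m → ∂F (f ∗ g) m ≈ sumTo (suc (suc m)) (λ k → f k * ∂F (x̂^ k g) m)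
  ∂F-∗ f g m = trans (*-distribˡ-sumTo (suc (suc m)) _ _)
    (sumTo-cong (suc (suc m)) (λ k _ → x∙yz≈y∙xz _ (f k) _))

  ∗-extend : ∀ f g m → sumTo (suc (suc m)) (λ k → f k * x̂^ k g m) ≈ (f ∗ g) m
  ∗-extend f g m = trans (+-congˡ (trans (*-congˡ (x̂^-raises-degree (suc m) g ≤-refl)) (zeroʳ _)))
    (+-identityʳ _)

  leibniz : ∀ f g → ∂F (f ∗ g) ≋ ((D f ∗ g) ⊕ (f ∗ ∂F g))
  leibniz f g m = begin
    ∂F (f ∗ g) m
      ≈⟨ ∂F-∗ f g m ⟩
    sumTo (suc (suc m)) (λ k → f k * ∂F (x̂^ k g) m)
      ≈⟨ sumTo-suc-head (suc m) _ ⟩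
    f 0 * ∂F g m + sumTo (suc m) (λ k → f (suc k) * ∂F (x̂^ (suc k) g) m)
      ≈⟨ +-congˡ (sumTo-cong (suc m) (λ k _ → commute k)) ⟩
    f 0 * ∂F g m + sumTo (suc m) (λ k → D f k * x̂^ k g m + f (suc k) * x̂^ (suc k) (∂F g) m)
      ≈⟨ +-congˡ (sumTo-+ (suc m) _ _) ⟩
    f 0 * ∂F g m + ((D f ∗ g) m + S)
      ≈⟨ solve 3 (λ a b c → a :+ (b :+ c) := b :+ (a :+ c)) refl _ _ S ⟩
    (D f ∗ g) m + (f 0 * ∂F g m + S)
      ≈⟨ +-congˡ (trans (sym (sumTo-suc-head (suc m) _)) (∗-extend f (∂F g) m)) ⟩
    (D f ∗ g) m + (f ∗ ∂F g) m
      ∎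
    where
    S = sumTo (suc m) (λ k → f (suc k) * x̂^ (suc k) (∂F g) m)
    commute : ∀ k → f (suc k) * ∂F (x̂^ (suc k) g) m ≈ D f k * x̂^ k g m + f (suc k) * x̂^ (suc k) (∂F g) m
    commute k = trans (*-congˡ (∂F-x̂^ k g m))
      (solve 4 (λ a n x y → a :* (n :* x :+ y) := (n :* a) :* x :+ a :* y) refl
             (f (suc k)) (nat (suc k)) (x̂^ k g m) (x̂^ (suc k) (∂F g) m))

  _⊡_ : Series → Series → Series
  (f ⊡ g) n = f n * g n

  starCoeff : Series
  starCoeff zero = 1#
  starCoeff (suc n) = nat (suc n) * inv (fib (suc n)) * starCoeff n

  starCoeff-closed : ∀ n → starCoeff n ≈ nat (n !) * inv (fibFact n)
  starCoeff-closed zero = sym (recip-inv 0)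
  starCoeff-closed (suc n) = begin
    (s * i) * starCoeff n                              ≈⟨ *-congˡ (starCoeff-closed n) ⟩
    (s * i) * (nat (n !) * inv (fibFact n))            ≈⟨ interchange s i _ _ ⟩
    (s * nat (n !)) * (i * inv (fibFact n))
      ≈⟨ *-cong (sym (natR-* (suc n) (n !)))
                (sym (inv-* (fib (suc n)) (fibFact n) {{fib-nonZero n}} {{fibFact-nonZero n}})) ⟩
    nat (suc n !) * inv (fibFact (suc n))              ∎
    where s = nat (suc n); i = inv (fib (suc n))

  starPow-diagonal : ∀ m → starPow m m ≈ starCoeff m
  starPow-diagonal zero = refl
  starPow-diagonal (suc m) = *-congˡ (starPow-diagonal m)

  starPow-offDiagonal : ∀ {k m} → k N.< m → starPow k m ≈ 0#
  starPow-offDiagonal {zero} {suc m} _ = refl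
  starPow-offDiagonal {suc k} {suc m} (s≤s k<m) = trans (*-congˡ (starPow-offDiagonal k<m)) (zeroʳ _)

  ∗-𝟏 : ∀ f → (f ∗ 𝟏) ≋ (starCoeff ⊡ f)
  ∗-𝟏 f m = begin
    sumTo m (λ k → f k * starPow k m) + f m * starPow m m
      ≈⟨ +-cong (sumTo-zero m _ (λ k k<m → trans (*-congˡ (starPow-offDiagonal k<m)) (zeroʳ _)))
                (*-congˡ (starPow-diagonal m)) ⟩
    0# + f m * starCoeff m  ≈⟨ +-identityˡ _ ⟩
    f m * starCoeff m       ≈⟨ *-comm _ _ ⟩
    starCoeff m * f m       ∎

  x̂^-⊡ : ∀ k {m} h → k N.≤ m → x̂^ k (starCoeff ⊡ h) m ≈ starCoeff m * h (m N.∸ k)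
  x̂^-⊡ zero h _ = refl
  x̂^-⊡ (suc k) {suc m} h (s≤s k≤m) = trans (*-congˡ (x̂^-⊡ k h k≤m)) (sym (*-assoc _ _ _))

  ∗-⊡ : ∀ f h → (f ∗ (starCoeff ⊡ h)) ≋ (starCoeff ⊡ (f ⊙ h))
  ∗-⊡ f h m = begin
    sumTo (suc m) (λ k → f k * x̂^ k (starCoeff ⊡ h) m)
      ≈⟨ sumTo-cong (suc m) (λ k k<1+m → trans (*-congˡ (x̂^-⊡ k h (≤-pred k<1+m))) (x∙yz≈y∙xz _ _ _)) ⟩
    sumTo (suc m) (λ k → starCoeff m * (f k * h (m N.∸ k)))
      ≈⟨ sym (*-distribˡ-sumTo (suc m) _ _) ⟩
    starCoeff m * (f ⊙ h) m
      ∎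

  ⊙-∗-𝟏 : ∀ f g → ((f ⊙ g) ∗ 𝟏) ≋ (f ∗ (g ∗ 𝟏))
  ⊙-∗-𝟏 f g m = begin
    ((f ⊙ g) ∗ 𝟏) m           ≈⟨ ∗-𝟏 (f ⊙ g) m ⟩
    (starCoeff ⊡ (f ⊙ g)) m   ≈⟨ sym (∗-⊡ f g m) ⟩
    (f ∗ (starCoeff ⊡ g)) m   ≈⟨ ∗-congʳ f (λ n → sym (∗-𝟏 g n)) m ⟩
    (f ∗ (g ∗ 𝟏)) m           ∎

  starCoeff-⊡-expS : ∀ α → (starCoeff ⊡ expS α) ≋ expF α
  starCoeff-⊡-expS α k = begin
    starCoeff k * (p * inv (k !))              ≈⟨ *-congʳ (starCoeff-closed k) ⟩
    (nat (k !) * q) * (p * inv (k !))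
      ≈⟨ solve 4 (λ n q p i → (n :* q) :* (p :* i) := p :* ((n :* i) :* q)) refl (nat (k !)) q p (inv (k !)) ⟩
    p * ((nat (k !) * inv (k !)) * q)          ≈⟨ *-congˡ (*-congʳ (inv-inverseʳ (k !) {{k !≢0}})) ⟩
    p * (1# * q)                               ≈⟨ *-congˡ (*-identityˡ q) ⟩
    p * q                                      ∎
    where p = pow α k; q = inv (fibFact k)

  expF≋expHat𝟏 : ∀ α → expF α ≋ expHat𝟏 α
  expF≋expHat𝟏 α k = sym (trans (∗-𝟏 (expS α) k) (starCoeff-⊡-expS α k))

  D-expS : ∀ α → D (expS α) ≋ (α · expS α)
  D-expS = weightedD-eigen-exp (λ n → n) _! (λ _ → _) _!≢0 (λ _ → ≡.refl)

  ∂F-expF : ∀ β → ∂F (expF β) ≋ (β · expF β)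
  ∂F-expF = weightedD-eigen-exp fib fibFact fib-nonZero fibFact-nonZero (λ _ → ≡.refl)

  expS∗expF : ∀ α β → (expS α ∗ expF β) ≋ expF (α + β)
  expS∗expF α β = weightedD-eigen-unique fib fib-nonZero (α + β) eigen (∂F-expF (α + β)) constant
    where
    E = expS α ∗ expF β

    eigen : ∂F E ≋ ((α + β) · E)
    eigen n = begin
      ∂F E n                                                ≈⟨ leibniz (expS α) (expF β) n ⟩
      (D (expS α) ∗ expF β) n + (expS α ∗ ∂F (expF β)) n
        ≈⟨ +-cong (∗-congˡ (expF β) (D-expS α) n) (∗-congʳ (expS α) (∂F-expF β) n) ⟩
      ((α · expS α) ∗ expF β) n + (expS α ∗ (β · expF β)) n
        ≈⟨ +-cong (∗-·ˡ α (expS α) (expF β) n) (∗-·ʳ β (expS α) (expF β) n) ⟩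
      α * E n + β * E n                                     ≈⟨ sym (distribʳ (E n) α β) ⟩
      (α + β) * E n                                         ∎

    exp-0 : 1# * inv 1 ≈ 1#
    exp-0 = trans (*-identityˡ (inv 1)) inv-1

    constant : E 0 ≈ expF (α + β) 0
    constant = begin
      0# + expS α 0 * expF β 0  ≈⟨ +-identityˡ _ ⟩
      expS α 0 * expF β 0       ≈⟨ *-cong exp-0 exp-0 ⟩
      1# * 1#                   ≈⟨ *-identityˡ 1# ⟩
      1#                        ≈⟨ sym exp-0 ⟩
      expF (α + β) 0            ∎

mainTheorem1 : ∀ {c ℓ} (A : QAlgebra c ℓ) → let open QOps A in
    -- (a)
    (∂F (starPow 0) ≋ zeroS × (∀ n → ∂F (starPow (suc n)) ≋ (nat (suc n) · starPow n)))
    -- (b)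
    × (∀ α → expF α ≋ expHat𝟏 α)
    -- (c)
    × (∀ α β → (expS α ∗ expF β) ≋ expF (α + β))
    -- (d)
    × (∀ k n → ∂F (mono k ∗ starPow n) ≋ ((D (mono k) ∗ starPow n) ⊕ (mono k ∗ ∂F (starPow n))))
    -- (e)
    × (∀ f g → ∂F (f ∗ g) ≋ ((D f ∗ g) ⊕ (f ∗ ∂F g)))
    -- (f)
    × (∀ f g → applyAt (f ⊙ g) 𝟏 ≋ (f ∗ applyAt g 𝟏))
mainTheorem1 A =
    (∂F-𝟏 , ∂F-starPow)
  , expF≋expHat𝟏
  , expS∗expF
  , (λ k n → leibniz (mono k) (starPow n))
  , leibniz
  , ⊙-∗-𝟏
  where
  open QOps A using (mono; starPow)
  open Development A
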